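{- Let $Z=(U,\Omega,\mathcal{C})$ be a tight multimatroid in which every skew class has at least two elements, and let $\omega,\omega'$ be distinct skew classes that both intersect some circuit $C$ of $Z$. Then there is a circuit $C'$ of $Z$ such that $\mathrm{Sc}(C\cup C')=\{\omega,\omega'\}$.
   Context: A carrier is $(U,\Omega)$ with $\Omega$ a partition of finite $U$ into skew classes; a skew pair is a 2-subset of a skew class; transversals meet each class in exactly one element, subtransversals are subsets of transversals. A semi-multimatroid $Z=(U,\Omega,\mathcal{C})$ has circuits $\mathcal{C}$ (subtransversals) such that each $(T,\mathcal{C}\cap 2^T)$, $T$ a transversal, is a matroid (by circuits); $Z[S]=(S,\mathcal C\cap 2^S)$ for subtransversals $S$. A multimatroid: no union of two circuits contains exactly one skew pair; tight: for every subtransversal $S$ with $|S|=|\Omega|-1$ and $\omega$ the class disjoint from $S$, some $x\in\omega$ makes the circuit families of $Z[S\cup\{x\}]$ and $Z[S]$ differ. For $W\subseteq U$, $\mathrm{Sc}(W)=\{\omega\in\Omega:|W\cap\omega|\ge 2\}$. -}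

module Defs where

open import Data.Nat using (ℕ; _∸_)
open import Data.Fin using (Fin)
open import Data.Fin.Subset using (Subset; _∈_; _∉_; _⊆_; _∪_; ⁅_⁆; ∣_∣; Nonempty)
open import Data.Bool using (Bool; true)
open import Data.Product using (Σ; ∃; _×_; _,_)
open import Data.Sum using (_⊎_)
open import Relation.Binary.PropositionalEquality using (_≡_; _≢_)
open import Relation.Nullary using (¬_)

-- A carrier (U, Ω): U = Fin n (finite ground set), the partition Ω of U into
-- skew classes is given by a class map σ : Fin n → Fin k (class c = σ⁻¹(c)).
-- Nonemptiness of classes is part of the hypotheses where needed.
record Carrier : Set where
  field
    n : ℕ
    k : ℕ
    σ : Fin n → Fin k

module _ (Ca : Carrier) where
  open Carrier Ca

  IsSubtransversal : Subset n → Set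
  IsSubtransversal S = ∀ x y → x ∈ S → y ∈ S → σ x ≡ σ y → x ≡ y

  IsTransversal : Subset n → Set
  IsTransversal T = IsSubtransversal T × (∀ (c : Fin k) → ∃ λ x → x ∈ T × σ x ≡ c)

  SkewPairIn : Subset n → Fin n → Fin n → Set
  SkewPairIn W x y = x ≢ y × σ x ≡ σ y × x ∈ W × y ∈ W

  ExactlyOneSkewPair : Subset n → Set
  ExactlyOneSkewPair W =
    ∃ λ x → ∃ λ y → SkewPairIn W x y ×
      (∀ x' y' → SkewPairIn W x' y' → (x' ≡ x × y' ≡ y) ⊎ (x' ≡ y × y' ≡ x))

  InSc : Subset n → Fin k → Set
  InSc W c = ∃ λ x → ∃ λ y → x ≢ y × x ∈ W × y ∈ W × σ x ≡ c × σ y ≡ c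

  ClassesAtLeastTwo : Set
  ClassesAtLeastTwo = ∀ (c : Fin k) → ∃ λ x → ∃ λ y → x ≢ y × σ x ≡ c × σ y ≡ c

Family : ℕ → Set
Family n = Subset n → Bool

module _ {n : ℕ} (𝒞 : Family n) where
  Mem : Subset n → Set
  Mem C = 𝒞 C ≡ true

  IsMatroidOn : Subset n → Set
  IsMatroidOn T =
    (∀ C → Mem C → C ⊆ T → Nonempty C) ×
    (∀ C₁ C₂ → Mem C₁ → Mem C₂ → C₁ ⊆ T → C₂ ⊆ T → C₁ ⊆ C₂ → C₁ ≡ C₂) ×
    (∀ C₁ C₂ e → Mem C₁ → Mem C₂ → C₁ ⊆ T → C₂ ⊆ T → C₁ ≢ C₂ → e ∈ C₁ → e ∈ C₂ →
       ∃ λ C₃ → Mem C₃ × C₃ ⊆ (C₁ ∪ C₂) × e ∉ C₃)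

record SemiMultimatroid (Ca : Carrier) : Set where
  open Carrier Ca
  field
    circ : Family n
    circ-subtransversal : ∀ C → Mem circ C → IsSubtransversal Ca C
    circ-matroid : ∀ T → IsTransversal Ca T → IsMatroidOn circ T

module _ {Ca : Carrier} (Z : SemiMultimatroid Ca) where
  open Carrier Ca
  open SemiMultimatroid Z

  IsCircuit : Subset n → Set
  IsCircuit = Mem circ

  IsMultimatroid : Set
  IsMultimatroid = ∀ C₁ C₂ → IsCircuit C₁ → IsCircuit C₂ → ¬ ExactlyOneSkewPair Ca (C₁ ∪ C₂)

  -- circuit family of the minor Z[S] = circuits contained in S
  CircOf : Subset n → Subset n → Set
  CircOf S C = IsCircuit C × C ⊆ S

  IsTight : Set
  IsTight = ∀ S (c : Fin k) → IsSubtransversal Ca S → ∣ S ∣ ≡ k ∸ 1 →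
    (∀ y → y ∈ S → σ y ≢ c) →
    ∃ λ x → σ x ≡ c × ∃ λ C →
      (CircOf (S ∪ ⁅ x ⁆) C × ¬ CircOf S C) ⊎ (CircOf S C × ¬ CircOf (S ∪ ⁅ x ⁆) C)

-- Let x ∈ C have class ω and y ∈ C class ω'. First extend C to a transversal T
-- in which C is the only circuit through x: a class c is added one element at a
-- time, and if both candidates b₁, b₂ ∈ c created circuits through x leaving C,
-- the union of those two circuits would contain the single skew pair {b₁, b₂}.
-- Then swap y for another element y' of ω' and drop x; tightness at the
-- resulting subtransversal S' yields a circuit D ⊆ S' ∪ {x'} through some x' ∈ ω.
-- Every skew pair of C ∪ D is {x, x'} or {y, y'}. Having neither forces D = C,
-- having exactly one contradicts the multimatroid axiom, so C ∪ D has both.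
module Submission where

open import Data.Bool using (true) renaming (_≟_ to _≟ᵇ_)
open import Data.Empty using (⊥; ⊥-elim)
open import Data.Fin using (Fin; zero; suc; _≟_)
open import Data.Fin.Properties using (any?; suc-injective)
open import Data.Fin.Subset hiding (⊥)
open import Data.Fin.Subset.Properties
open import Data.List using (List; []; _∷_; allFin)
open import Data.List.Membership.Propositional using () renaming (_∈_ to _∈ˡ_)
open import Data.List.Membership.Propositional.Properties using (∈-allFin)
open import Data.List.Relation.Unary.Any using (here; there)
open import Data.Nat using (ℕ; suc; _∸_)
open import Data.Product using (∃; _×_; _,_; proj₁; proj₂)
open import Data.Sum using (_⊎_; inj₁; inj₂; [_,_]′; map; map₂)
open import Data.Vec using ([]; _∷_; here; there)
open import Function using (id; _∘_)
open import Function.Bundles using (_⇔_; mk⇔)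
open import Relation.Nullary using (¬_; Dec; yes; no)
open import Relation.Nullary.Decidable using (_×-dec_; ¬?)
open import Relation.Binary.PropositionalEquality using (_≡_; _≢_; refl; sym; trans; cong; subst)
open import Defs

private variable
  m : ℕ

x∈p─q⇒x∉q : ∀ {x : Fin m} (p q : Subset m) → x ∈ p ─ q → x ∉ q
x∈p─q⇒x∉q {x = zero} (a ∷ p) (inside ∷ q) ()
x∈p─q⇒x∉q {x = zero} (a ∷ p) (outside ∷ q) here = λ ()
x∈p─q⇒x∉q {x = suc x} (a ∷ p) (b ∷ q) (there h) = x∈p─q⇒x∉q p q h ∘ drop-there

x∈p-y⇒x≢y : ∀ {x : Fin m} (p : Subset m) y → x ∈ p - y → x ≢ y
x∈p-y⇒x≢y p y = x∉⁅y⁆⇒x≢y ∘ x∈p─q⇒x∉q p ⁅ y ⁆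

x∈p⇒suc∣p-x∣≡∣p∣ : ∀ (p : Subset m) x → x ∈ p → suc ∣ p - x ∣ ≡ ∣ p ∣
x∈p⇒suc∣p-x∣≡∣p∣ (inside ∷ p) zero here = cong suc (cong ∣_∣ (p─⊥≡p p))
x∈p⇒suc∣p-x∣≡∣p∣ (inside ∷ p) (suc x) (there h) = cong suc (x∈p⇒suc∣p-x∣≡∣p∣ p x h)
x∈p⇒suc∣p-x∣≡∣p∣ (outside ∷ p) (suc x) (there h) = x∈p⇒suc∣p-x∣≡∣p∣ p x h

x∈p∪⁅y⁆⁻ : ∀ (p : Subset m) y {x} → x ∈ p ∪ ⁅ y ⁆ → x ∈ p ⊎ x ≡ y
x∈p∪⁅y⁆⁻ p y = map₂ (x∈⁅y⁆⇒x≡y y) ∘ x∈p∪q⁻ p ⁅ y ⁆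

y∈p∪⁅y⁆ : ∀ (p : Subset m) y → y ∈ p ∪ ⁅ y ⁆
y∈p∪⁅y⁆ p y = q⊆p∪q p ⁅ y ⁆ (x∈⁅x⁆ y)

p⊆q∪⁅y⁆∧y∉p⇒p⊆q : ∀ {p q : Subset m} {y} → p ⊆ q ∪ ⁅ y ⁆ → y ∉ p → p ⊆ q
p⊆q∪⁅y⁆∧y∉p⇒p⊆q {q = q} {y} p⊆q+y y∉p {z} z∈p with x∈p∪⁅y⁆⁻ q y (p⊆q+y z∈p)
... | inj₁ z∈q = z∈q
... | inj₂ refl = ⊥-elim (y∉p z∈p)

injectiveOn-onto⇒∣p∣≡∣q∣ : ∀ {k} (f : Fin m → Fin k) (P : Subset m) (Q : Subset k) →
  (∀ a b → a ∈ P → b ∈ P → f a ≡ f b → a ≡ b) →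
  (∀ a → a ∈ P → f a ∈ Q) → (∀ c → c ∈ Q → ∃ λ a → a ∈ P × f a ≡ c) → ∣ P ∣ ≡ ∣ Q ∣
injectiveOn-onto⇒∣p∣≡∣q∣ {k = k} f [] Q _ _ onto =
  sym (trans (cong ∣_∣ (Empty-unique λ { (c , c∈Q) → nothing-in-[] (onto c c∈Q) })) (∣⊥∣≡0 k))
  where nothing-in-[] : ∀ {c} → ¬ ∃ λ a → a ∈ [] × f a ≡ c
        nothing-in-[] (() , _)
injectiveOn-onto⇒∣p∣≡∣q∣ f (outside ∷ P) Q inj into onto =
  injectiveOn-onto⇒∣p∣≡∣q∣ (f ∘ suc) P Q
    (λ a b a∈P b∈P → suc-injective ∘ inj (suc a) (suc b) (there a∈P) (there b∈P))
    (λ a → into (suc a) ∘ there) onto′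
  where onto′ : ∀ c → c ∈ Q → ∃ λ a → a ∈ P × f (suc a) ≡ c
        onto′ c c∈Q with onto c c∈Q
        ... | suc a , there a∈P , fa≡c = a , a∈P , fa≡c
injectiveOn-onto⇒∣p∣≡∣q∣ f (inside ∷ P) Q inj into onto =
  trans (cong suc (injectiveOn-onto⇒∣p∣≡∣q∣ (f ∘ suc) P (Q - f zero)
      (λ a b a∈P b∈P → suc-injective ∘ inj (suc a) (suc b) (there a∈P) (there b∈P))
      (λ a a∈P → x∈p∧x≢y⇒x∈p-y (into (suc a) (there a∈P)) (f-suc≢f0 a∈P))
      onto′))
    (x∈p⇒suc∣p-x∣≡∣p∣ Q (f zero) (into zero here))
  where f-suc≢f0 : ∀ {a} → a ∈ P → f (suc a) ≢ f zero
        f-suc≢f0 a∈P eq with inj zero _ here (there a∈P) (sym eq)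
        ... | ()
        onto′ : ∀ c → c ∈ Q - f zero → ∃ λ a → a ∈ P × f (suc a) ≡ c
        onto′ c c∈Q-f0 with onto c (p─q⊆p Q ⁅ f zero ⁆ c∈Q-f0)
        ... | zero , _ , refl = ⊥-elim (x∈p-y⇒x≢y Q (f zero) c∈Q-f0 refl)
        ... | suc a , there a∈P , fa≡c = a , a∈P , fa≡c

SamePair : {A : Set} → A → A → A → A → Set
SamePair a b u v = (a ≡ u × b ≡ v) ⊎ (a ≡ v × b ≡ u)

samePair-of-two : {A : Set} {a b u v : A} →
  a ≢ b → a ≡ u ⊎ a ≡ v → b ≡ u ⊎ b ≡ v → SamePair a b u v
samePair-of-two a≢b (inj₁ refl) (inj₁ refl) = ⊥-elim (a≢b refl)
samePair-of-two _   (inj₁ a≡u)  (inj₂ b≡v)  = inj₁ (a≡u , b≡v)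
samePair-of-two _   (inj₂ a≡v)  (inj₁ b≡u)  = inj₂ (a≡v , b≡u)
samePair-of-two a≢b (inj₂ refl) (inj₂ refl) = ⊥-elim (a≢b refl)

samePair-degenerate : {A : Set} {a b u : A} → SamePair a b u u → a ≡ b
samePair-degenerate (inj₁ (refl , refl)) = refl
samePair-degenerate (inj₂ (refl , refl)) = refl

samePair-fst : {A : Set} {a b u v : A} → SamePair a b u v → a ≡ u ⊎ a ≡ v
samePair-fst (inj₁ (a≡u , _)) = inj₁ a≡u
samePair-fst (inj₂ (a≡v , _)) = inj₂ a≡v

samePair-∈ : {A : Set} {W : A → Set} {a b u v : A} → SamePair a b u v → W a → W b → W v
samePair-∈ (inj₁ (refl , refl)) _ b∈W = b∈W
samePair-∈ (inj₂ (refl , refl)) a∈W _ = a∈W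

module _ (Ca : Carrier) where
  open Carrier Ca

  Meets : Subset n → Fin k → Set
  Meets P c = ∃ λ z → z ∈ P × σ z ≡ c

  meets? : ∀ P c → Dec (Meets P c)
  meets? P c = any? λ z → (z ∈? P) ×-dec (σ z ≟ c)

  Meets-mono : ∀ {P Q c} → P ⊆ Q → Meets P c → Meets Q c
  Meets-mono P⊆Q (z , z∈P , σz≡c) = z , P⊆Q z∈P , σz≡c

  another-in-class : ClassesAtLeastTwo Ca → ∀ y → ∃ λ y' → y' ≢ y × σ y' ≡ σ y
  another-in-class two y with two (σ y)
  ... | u , v , u≢v , σu , σv with u ≟ y
  ... | yes refl = v , u≢v ∘ sym , σv
  ... | no u≢y   = u , u≢y , σu

  subtransversal-⊆ : ∀ {P Q} → P ⊆ Q → IsSubtransversal Ca Q → IsSubtransversal Ca P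
  subtransversal-⊆ P⊆Q st a b a∈P b∈P = st a b (P⊆Q a∈P) (P⊆Q b∈P)

  subtransversal-∪⁅⁆ : ∀ {P b} → IsSubtransversal Ca P → (∀ z → z ∈ P → σ z ≢ σ b) →
    IsSubtransversal Ca (P ∪ ⁅ b ⁆)
  subtransversal-∪⁅⁆ {P} {b} st avoid a a' a∈ a'∈ σa≡σa'
    with x∈p∪⁅y⁆⁻ P b a∈ | x∈p∪⁅y⁆⁻ P b a'∈
  ... | inj₁ a∈P  | inj₁ a'∈P = st a a' a∈P a'∈P σa≡σa'
  ... | inj₁ a∈P  | inj₂ refl = ⊥-elim (avoid a a∈P σa≡σa')
  ... | inj₂ refl | inj₁ a'∈P = ⊥-elim (avoid a' a'∈P (sym σa≡σa'))
  ... | inj₂ refl | inj₂ refl = refl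

  skewPair-outside : ∀ {P W : Subset n} {Q : Fin n → Set} {a b} → IsSubtransversal Ca P →
    (∀ {z} → z ∈ W → z ∈ P ⊎ Q z) → (∀ {p q} → p ∈ P → Q q → σ p ≢ σ q) →
    SkewPairIn Ca W a b → Q a × Q b
  skewPair-outside st split sep (a≢b , σa≡σb , a∈W , b∈W) with split a∈W | split b∈W
  ... | inj₁ a∈P | inj₁ b∈P = ⊥-elim (a≢b (st _ _ a∈P b∈P σa≡σb))
  ... | inj₁ a∈P | inj₂ Qb  = ⊥-elim (sep a∈P Qb σa≡σb)
  ... | inj₂ Qa  | inj₁ b∈P = ⊥-elim (sep b∈P Qa (sym σa≡σb))
  ... | inj₂ Qa  | inj₂ Qb  = Qa , Qb

  ∣subtransversal∣≡k∸1 : ∀ {S c} → IsSubtransversal Ca S → (∀ z → z ∈ S → σ z ≢ c) →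
    (∀ c' → c' ≢ c → Meets S c') → ∣ S ∣ ≡ k ∸ 1
  ∣subtransversal∣≡k∸1 {S} {c} st avoid meets =
    trans (injectiveOn-onto⇒∣p∣≡∣q∣ σ S (∁ ⁅ c ⁆) st
            (λ z z∈S → x∉p⇒x∈∁p (x≢y⇒x∉⁅y⁆ (avoid z z∈S)))
            (λ c' c'∈ → meets c' (x∉⁅y⁆⇒x≢y (x∈∁p⇒x∉p c'∈))))
          (trans (∣∁p∣≡n∸∣p∣ ⁅ c ⁆) (cong (k ∸_) (∣⁅x⁆∣≡1 c)))

  saturate : (Good : Subset n → Set) →
    (∀ {X} c → Good X → ¬ Meets X c → ∃ λ X' → Good X' × X ⊆ X' × Meets X' c) →
    ∀ {X} → Good X → ∃ λ T → Good T × X ⊆ T × (∀ c → Meets T c)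
  saturate Good grow {X} good =
    let T , goodT , X⊆T , meets-listed = meet-all (allFin k)
    in T , goodT , X⊆T , λ c → meets-listed c (∈-allFin c)
    where
      meet : ∀ {Y} c → Good Y → ∃ λ Y' → Good Y' × Y ⊆ Y' × Meets Y' c
      meet {Y} c goodY with meets? Y c
      ... | yes m = Y , goodY , id , m
      ... | no ¬m = grow c goodY ¬m
      meet-all : (L : List (Fin k)) → ∃ λ T → Good T × X ⊆ T × (∀ c → c ∈ˡ L → Meets T c)
      meet-all [] = X , good , id , λ _ ()
      meet-all (c ∷ L) with meet-all L
      ... | Y , goodY , X⊆Y , meetsL with meet c goodY
      ... | T , goodT , Y⊆T , meets-c = T , goodT , Y⊆T ∘ X⊆Y , meets
        where meets : ∀ c' → c' ∈ˡ c ∷ L → Meets T c'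
              meets c' (here refl)  = meets-c
              meets c' (there c'∈L) = Meets-mono Y⊆T (meetsL c' c'∈L)

module _ {Ca : Carrier} (Z : SemiMultimatroid Ca) where
  open Carrier Ca
  open SemiMultimatroid Z

  CircuitsThrough_Within_LieIn_ : Fin n → Subset n → Subset n → Set
  CircuitsThrough x Within Y LieIn C = ∀ D → IsCircuit Z D → D ⊆ Y → x ∈ D → D ⊆ C

  EscapingCircuit : Fin n → Subset n → Subset n → Subset n → Set
  EscapingCircuit x Y C D = IsCircuit Z D × D ⊆ Y × x ∈ D × ¬ D ⊆ C

  confined-or-escaping : ∀ x Y C →
    CircuitsThrough x Within Y LieIn C ⊎ ∃ (EscapingCircuit x Y C)
  confined-or-escaping x Y C
    with anySubset? (λ D → (circ D ≟ᵇ true) ×-dec (D ⊆? Y) ×-dec (x ∈? D) ×-dec ¬? (D ⊆? C))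
  ... | yes escaping = inj₂ escaping
  ... | no ¬escaping = inj₁ λ D D-circ D⊆Y x∈D → inside-C D D-circ D⊆Y x∈D (D ⊆? C)
    where inside-C : ∀ D → IsCircuit Z D → D ⊆ Y → x ∈ D → Dec (D ⊆ C) → D ⊆ C
          inside-C D _ _ _ (yes D⊆C) = D⊆C
          inside-C D D-circ D⊆Y x∈D (no D⊈C) = ⊥-elim (¬escaping (D , D-circ , D⊆Y , x∈D , D⊈C))

  escaping-contains-new : ∀ {x Y C D b} → CircuitsThrough x Within Y LieIn C →
    EscapingCircuit x (Y ∪ ⁅ b ⁆) C D → b ∈ D
  escaping-contains-new {x} {Y} {C} {D} {b} confined (D-circ , D⊆Y+b , x∈D , D⊈C) with b ∈? D
  ... | yes b∈D = b∈D
  ... | no b∉D = ⊥-elim (D⊈C (confined D D-circ (p⊆q∪⁅y⁆∧y∉p⇒p⊆q D⊆Y+b b∉D) x∈D))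

  confinement-extends : IsMultimatroid Z → ∀ {x Y C b₁ b₂} → IsSubtransversal Ca Y →
    b₁ ≢ b₂ → σ b₁ ≡ σ b₂ → (∀ z → z ∈ Y → σ z ≢ σ b₁) →
    CircuitsThrough x Within Y LieIn C →
    CircuitsThrough x Within (Y ∪ ⁅ b₁ ⁆) LieIn C ⊎ CircuitsThrough x Within (Y ∪ ⁅ b₂ ⁆) LieIn C
  confinement-extends mm {x} {Y} {C} {b₁} {b₂} st b₁≢b₂ σb₁≡σb₂ avoid confined
    with confined-or-escaping x (Y ∪ ⁅ b₁ ⁆) C | confined-or-escaping x (Y ∪ ⁅ b₂ ⁆) C
  ... | inj₁ confined₁ | _ = inj₁ confined₁
  ... | inj₂ _ | inj₁ confined₂ = inj₂ confined₂
  ... | inj₂ (D₁ , esc₁) | inj₂ (D₂ , esc₂) = ⊥-elim (mm D₁ D₂ (proj₁ esc₁) (proj₁ esc₂) single)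
    where
      split : ∀ {z} → z ∈ D₁ ∪ D₂ → z ∈ Y ⊎ (z ≡ b₁ ⊎ z ≡ b₂)
      split z∈ with x∈p∪q⁻ D₁ D₂ z∈
      ... | inj₁ z∈D₁ = map₂ inj₁ (x∈p∪⁅y⁆⁻ Y b₁ (proj₁ (proj₂ esc₁) z∈D₁))
      ... | inj₂ z∈D₂ = map₂ inj₂ (x∈p∪⁅y⁆⁻ Y b₂ (proj₁ (proj₂ esc₂) z∈D₂))
      separated : ∀ {p q} → p ∈ Y → q ≡ b₁ ⊎ q ≡ b₂ → σ p ≢ σ q
      separated p∈Y (inj₁ refl) = avoid _ p∈Y
      separated p∈Y (inj₂ refl) σp≡σb₂ = avoid _ p∈Y (trans σp≡σb₂ (sym σb₁≡σb₂))
      single : ExactlyOneSkewPair Ca (D₁ ∪ D₂)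
      single = b₁ , b₂
             , (b₁≢b₂ , σb₁≡σb₂ , x∈p∪q⁺ (inj₁ (escaping-contains-new confined esc₁))
                                , x∈p∪q⁺ (inj₂ (escaping-contains-new confined esc₂)))
             , λ a b pair → let (Qa , Qb) = skewPair-outside Ca st split separated pair
                            in samePair-of-two (proj₁ pair) Qa Qb

  SoleCircuitThrough : Fin n → Subset n → Subset n → Set
  SoleCircuitThrough x T C = ∀ D → IsCircuit Z D → D ⊆ T → x ∈ D → D ≡ C

  transversal-with-sole-circuit-through : IsMultimatroid Z → ClassesAtLeastTwo Ca →
    ∀ {C} → IsCircuit Z C → ∀ x →
    ∃ λ T → IsTransversal Ca T × C ⊆ T × SoleCircuitThrough x T C
  transversal-with-sole-circuit-through mm two {C} C-circ x =
    let T , (T-st , confined) , C⊆T , meets =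
          saturate Ca Good grow (circ-subtransversal C C-circ , λ _ _ D⊆C _ → D⊆C)
        T-tr = T-st , meets
    in T , T-tr , C⊆T , λ D D-circ D⊆T x∈D →
         proj₁ (proj₂ (circ-matroid T T-tr)) D C D-circ C-circ D⊆T C⊆T (confined D D-circ D⊆T x∈D)
    where
      Good : Subset n → Set
      Good Y = IsSubtransversal Ca Y × CircuitsThrough x Within Y LieIn C
      grow : ∀ {Y} c → Good Y → ¬ Meets Ca Y c → ∃ λ Y' → Good Y' × Y ⊆ Y' × Meets Ca Y' c
      grow {Y} c (st , confined) ¬meets with two c
      ... | b₁ , b₂ , b₁≢b₂ , refl , σb₂≡σb₁ = extension
        where
          avoids : ∀ {b} → σ b ≡ σ b₁ → ∀ z → z ∈ Y → σ z ≢ σ b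
          avoids σb≡σb₁ z z∈Y σz≡σb = ¬meets (z , z∈Y , trans σz≡σb σb≡σb₁)
          extend : ∀ b → σ b ≡ σ b₁ → CircuitsThrough x Within (Y ∪ ⁅ b ⁆) LieIn C →
            ∃ λ Y' → Good Y' × Y ⊆ Y' × Meets Ca Y' (σ b₁)
          extend b σb≡σb₁ confined′ =
            Y ∪ ⁅ b ⁆ , (subtransversal-∪⁅⁆ Ca st (avoids σb≡σb₁) , confined′)
                      , p⊆p∪q ⁅ b ⁆ , (b , y∈p∪⁅y⁆ Y b , σb≡σb₁)
          extension : ∃ λ Y' → Good Y' × Y ⊆ Y' × Meets Ca Y' (σ b₁)
          extension with confinement-extends mm st b₁≢b₂ (sym σb₂≡σb₁) (avoids refl) confined
          ... | inj₁ confined₁ = extend b₁ refl confined₁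
          ... | inj₂ confined₂ = extend b₂ σb₂≡σb₁ confined₂

  tight⇒circuit-through-missing-class : IsTight Z → ∀ {S c} → IsSubtransversal Ca S →
    ∣ S ∣ ≡ k ∸ 1 → (∀ z → z ∈ S → σ z ≢ c) →
    ∃ λ e → σ e ≡ c × ∃ λ D → IsCircuit Z D × D ⊆ S ∪ ⁅ e ⁆ × e ∈ D
  tight⇒circuit-through-missing-class tight {S} {c} st card avoid with tight S c st card avoid
  ... | e , σe≡c , D , inj₂ ((D-circ , D⊆S) , ¬D⊆S+e) = ⊥-elim (¬D⊆S+e (D-circ , p⊆p∪q ⁅ e ⁆ ∘ D⊆S))
  ... | e , σe≡c , D , inj₁ ((D-circ , D⊆S+e) , ¬D⊆S) with e ∈? D
  ... | yes e∈D = e , σe≡c , D , D-circ , D⊆S+e , e∈D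
  ... | no e∉D = ⊥-elim (¬D⊆S (D-circ , p⊆q∪⁅y⁆∧y∉p⇒p⊆q D⊆S+e e∉D))

  module _ (mm : IsMultimatroid Z) (tight : IsTight Z) {T C : Subset n} {x y y' : Fin n}
    (T-tr : IsTransversal Ca T) (C-circ : IsCircuit Z C) (C⊆T : C ⊆ T)
    (sole : SoleCircuitThrough x T C) (x∈C : x ∈ C) (y∈C : y ∈ C)
    (σx≢σy : σ x ≢ σ y) (y'≢y : y' ≢ y) (σy'≡σy : σ y' ≡ σ y) where

    private
      T-st : IsSubtransversal Ca T
      T-st = proj₁ T-tr

      x∈T : x ∈ T
      x∈T = C⊆T x∈C

      y∈T : y ∈ T
      y∈T = C⊆T y∈C

      R : Subset n
      R = T - x - y

      R⊆T : R ⊆ T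
      R⊆T = p─q⊆p T ⁅ x ⁆ ∘ p─q⊆p (T - x) ⁅ y ⁆

      T-split : ∀ {z} → z ∈ T → z ∈ R ⊎ (z ≡ x ⊎ z ≡ y)
      T-split {z} z∈T with z ≟ x | z ≟ y
      ... | yes z≡x | _       = inj₂ (inj₁ z≡x)
      ... | no _    | yes z≡y = inj₂ (inj₂ z≡y)
      ... | no z≢x  | no z≢y  = inj₁ (x∈p∧x≢y⇒x∈p-y (x∈p∧x≢y⇒x∈p-y z∈T z≢x) z≢y)

      R-avoids-x : ∀ {z} → z ∈ R → σ z ≢ σ x
      R-avoids-x {z} z∈R σz≡σx =
        x∈p-y⇒x≢y T x (p─q⊆p (T - x) ⁅ y ⁆ z∈R) (T-st z x (R⊆T z∈R) x∈T σz≡σx)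

      R-avoids-y : ∀ {z} → z ∈ R → σ z ≢ σ y
      R-avoids-y {z} z∈R σz≡σy = x∈p-y⇒x≢y (T - x) y z∈R (T-st z y (R⊆T z∈R) y∈T σz≡σy)

      S' : Subset n
      S' = R ∪ ⁅ y' ⁆

      S'-st : IsSubtransversal Ca S'
      S'-st = subtransversal-∪⁅⁆ Ca (subtransversal-⊆ Ca R⊆T T-st)
                (λ z z∈R σz≡σy' → R-avoids-y z∈R (trans σz≡σy' σy'≡σy))

      S'-avoids-x : ∀ z → z ∈ S' → σ z ≢ σ x
      S'-avoids-x z z∈S' with x∈p∪⁅y⁆⁻ R y' z∈S'
      ... | inj₁ z∈R  = R-avoids-x z∈R
      ... | inj₂ refl = λ σy'≡σx → σx≢σy (trans (sym σy'≡σx) σy'≡σy)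

      S'-meets : ∀ c → c ≢ σ x → Meets Ca S' c
      S'-meets c c≢σx with proj₂ T-tr c
      ... | z , z∈T , refl with T-split z∈T
      ... | inj₁ z∈R         = z , p⊆p∪q ⁅ y' ⁆ z∈R , refl
      ... | inj₂ (inj₁ refl) = ⊥-elim (c≢σx refl)
      ... | inj₂ (inj₂ refl) = y' , y∈p∪⁅y⁆ R y' , σy'≡σy

      y'∉C : y' ∉ C
      y'∉C y'∈C = y'≢y (T-st y' y (C⊆T y'∈C) y∈T σy'≡σy)

      ω'-class : ∀ {z} → z ≡ y ⊎ z ≡ y' → σ z ≡ σ y
      ω'-class (inj₁ refl) = refl
      ω'-class (inj₂ refl) = σy'≡σy

      module _ {x' D} (σx'≡σx : σ x' ≡ σ x) (D-circ : IsCircuit Z D)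
               (D⊆S'∪x' : D ⊆ S' ∪ ⁅ x' ⁆) (x'∈D : x' ∈ D) where

        D-split : ∀ {z} → z ∈ D → z ∈ R ⊎ (z ≡ y' ⊎ z ≡ x')
        D-split z∈D with x∈p∪⁅y⁆⁻ S' x' (D⊆S'∪x' z∈D)
        ... | inj₁ z∈S' = map₂ inj₁ (x∈p∪⁅y⁆⁻ R y' z∈S')
        ... | inj₂ z≡x' = inj₂ (inj₂ z≡x')

        ω-class : ∀ {z} → z ≡ x ⊎ z ≡ x' → σ z ≡ σ x
        ω-class (inj₁ refl) = refl
        ω-class (inj₂ refl) = σx'≡σx

        Special : Fin n → Set
        Special z = (z ≡ x ⊎ z ≡ x') ⊎ (z ≡ y ⊎ z ≡ y')

        C∪D-split : ∀ {z} → z ∈ C ∪ D → z ∈ R ⊎ Special z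
        C∪D-split z∈ =
          [ map₂ [ inj₁ ∘ inj₁ , inj₂ ∘ inj₁ ]′ ∘ T-split ∘ C⊆T
          , map₂ [ inj₂ ∘ inj₂ , inj₁ ∘ inj₂ ]′ ∘ D-split
          ]′ (x∈p∪q⁻ C D z∈)

        R-separated : ∀ {p q} → p ∈ R → Special q → σ p ≢ σ q
        R-separated p∈R (inj₁ q-ω)  σp≡σq = R-avoids-x p∈R (trans σp≡σq (ω-class q-ω))
        R-separated p∈R (inj₂ q-ω') σp≡σq = R-avoids-y p∈R (trans σp≡σq (ω'-class q-ω'))

        skewPairs-of-C∪D : ∀ {a b} → SkewPairIn Ca (C ∪ D) a b → SamePair a b x x' ⊎ SamePair a b y y'
        skewPairs-of-C∪D pair@(a≢b , σa≡σb , _ , _)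
          with skewPair-outside Ca (subtransversal-⊆ Ca R⊆T T-st) C∪D-split R-separated pair
        ... | inj₁ a-ω  , inj₁ b-ω  = inj₁ (samePair-of-two a≢b a-ω b-ω)
        ... | inj₂ a-ω' , inj₂ b-ω' = inj₂ (samePair-of-two a≢b a-ω' b-ω')
        ... | inj₁ a-ω  , inj₂ b-ω' =
          ⊥-elim (σx≢σy (trans (sym (ω-class a-ω)) (trans σa≡σb (ω'-class b-ω'))))
        ... | inj₂ a-ω' , inj₁ b-ω  =
          ⊥-elim (σx≢σy (trans (sym (ω-class b-ω)) (trans (sym σa≡σb) (ω'-class a-ω'))))

        only-ω-pair : x' ≢ x → y' ∉ D → ExactlyOneSkewPair Ca (C ∪ D)
        only-ω-pair x'≢x y'∉D =
          x , x' , (x'≢x ∘ sym , sym σx'≡σx , x∈p∪q⁺ (inj₁ x∈C) , x∈p∪q⁺ (inj₂ x'∈D)) , unique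
          where
            unique : ∀ a b → SkewPairIn Ca (C ∪ D) a b → SamePair a b x x'
            unique a b pair@(_ , _ , a∈ , b∈) with skewPairs-of-C∪D pair
            ... | inj₁ ω-pair  = ω-pair
            ... | inj₂ ω'-pair = ⊥-elim ([ y'∉C , y'∉D ]′ (x∈p∪q⁻ C D (samePair-∈ ω'-pair a∈ b∈)))

        only-ω'-pair : x' ≡ x → y' ∈ D → ExactlyOneSkewPair Ca (C ∪ D)
        only-ω'-pair refl y'∈D =
          y , y' , (y'≢y ∘ sym , sym σy'≡σy , x∈p∪q⁺ (inj₁ y∈C) , x∈p∪q⁺ (inj₂ y'∈D)) , unique
          where
            unique : ∀ a b → SkewPairIn Ca (C ∪ D) a b → SamePair a b y y'
            unique a b pair@(a≢b , _) with skewPairs-of-C∪D pair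
            ... | inj₁ ω-pair  = ⊥-elim (a≢b (samePair-degenerate ω-pair))
            ... | inj₂ ω'-pair = ω'-pair

        -- D then lies in T and passes through x, so D = C ∋ y.
        neither-pair-impossible : x' ≡ x → y' ∉ D → ⊥
        neither-pair-impossible refl y'∉D = y∉D (subst (y ∈_) (sym D≡C) y∈C)
          where
            D⊆T : D ⊆ T
            D⊆T z∈D with D-split z∈D
            ... | inj₁ z∈R         = R⊆T z∈R
            ... | inj₂ (inj₁ refl) = ⊥-elim (y'∉D z∈D)
            ... | inj₂ (inj₂ refl) = x∈T
            D≡C : D ≡ C
            D≡C = sole D D-circ D⊆T x'∈D
            y∉D : y ∉ D
            y∉D y∈D with D-split y∈D
            ... | inj₁ y∈R         = R-avoids-y y∈R refl
            ... | inj₂ (inj₁ y≡y') = y'≢y (sym y≡y')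
            ... | inj₂ (inj₂ refl) = σx≢σy refl

        circuit-meeting-both : ∃ λ C' → IsCircuit Z C' ×
          (∀ c → InSc Ca (C ∪ C') c ⇔ (c ≡ σ x ⊎ c ≡ σ y))
        circuit-meeting-both with x' ≟ x | y' ∈? D
        ... | no x'≢x  | yes y'∈D = D , D-circ , λ c → mk⇔ to (from c)
          where
            to : ∀ {c} → InSc Ca (C ∪ D) c → c ≡ σ x ⊎ c ≡ σ y
            to (a , b , a≢b , a∈ , b∈ , refl , σb≡σa) =
              map (ω-class ∘ samePair-fst) (ω'-class ∘ samePair-fst)
                  (skewPairs-of-C∪D (a≢b , sym σb≡σa , a∈ , b∈))
            from : ∀ c → c ≡ σ x ⊎ c ≡ σ y → InSc Ca (C ∪ D) c
            from _ (inj₁ refl) =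
              x , x' , x'≢x ∘ sym , x∈p∪q⁺ (inj₁ x∈C) , x∈p∪q⁺ (inj₂ x'∈D) , refl , σx'≡σx
            from _ (inj₂ refl) =
              y , y' , y'≢y ∘ sym , x∈p∪q⁺ (inj₁ y∈C) , x∈p∪q⁺ (inj₂ y'∈D) , refl , σy'≡σy
        ... | no x'≢x  | no y'∉D  = ⊥-elim (mm C D C-circ D-circ (only-ω-pair x'≢x y'∉D))
        ... | yes x'≡x | yes y'∈D = ⊥-elim (mm C D C-circ D-circ (only-ω'-pair x'≡x y'∈D))
        ... | yes x'≡x | no y'∉D  = ⊥-elim (neither-pair-impossible x'≡x y'∉D)

    circuit-with-Sc-pair : ∃ λ C' → IsCircuit Z C' ×
      (∀ c → InSc Ca (C ∪ C') c ⇔ (c ≡ σ x ⊎ c ≡ σ y))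
    circuit-with-Sc-pair
      with tight⇒circuit-through-missing-class tight S'-st
             (∣subtransversal∣≡k∸1 Ca S'-st S'-avoids-x S'-meets) S'-avoids-x
    ... | x' , σx'≡σx , D , D-circ , D⊆S'∪x' , x'∈D = circuit-meeting-both σx'≡σx D-circ D⊆S'∪x' x'∈D

mainTheorem19 : (Ca : Carrier) → (Z : SemiMultimatroid Ca) →
    IsMultimatroid Z → IsTight Z → ClassesAtLeastTwo Ca →
    (ω ω' : Fin (Carrier.k Ca)) → ω ≢ ω' →
    (C : Subset (Carrier.n Ca)) → IsCircuit Z C →
    (∃ λ x → x ∈ C × Carrier.σ Ca x ≡ ω) →
    (∃ λ x → x ∈ C × Carrier.σ Ca x ≡ ω') →
    ∃ λ C' → IsCircuit Z C' ×
      (∀ (c : Fin (Carrier.k Ca)) → InSc Ca (C ∪ C') c ⇔ (c ≡ ω ⊎ c ≡ ω'))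
mainTheorem19 Ca Z mm tight two _ _ ω≢ω' C C-circ (x , x∈C , refl) (y , y∈C , refl)
  with transversal-with-sole-circuit-through Z mm two C-circ x | another-in-class Ca two y
... | T , T-tr , C⊆T , sole | y' , y'≢y , σy'≡σy =
  circuit-with-Sc-pair Z mm tight T-tr C-circ C⊆T sole x∈C y∈C ω≢ω' y'≢y σy'≡σy
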